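{- Let $\phi=\frac{1+\sqrt{5}}{2}$. The three sets $B=\{\lfloor n\phi^2 \rfloor : n\geqslant 1\}$, $B+1=\{\lfloor n\phi^2 \rfloor +1 : n\geqslant 0\}$, and $AB+1=\{2\lfloor n\phi \rfloor + n+1 : n\geqslant 1\}$ partition the set of positive integers (i.e. they are pairwise disjoint and their union is $\{1,2,3,\ldots\}$).
   Context: $\lfloor\cdot\rfloor$ denotes the floor function. The names $B$, $B+1$, $AB+1$ are just labels for the three sets as defined in the claim (note that $B+1$ includes the value $1$ coming from $n=0$). -}

module Defs where

open import Data.Nat using (ℕ; suc) renaming (_≤_ to _≤ℕ_)
open import Data.Integer using (ℤ; +_; _-_; _*_; _≤_; _<_)
open import Data.Product using (_×_; ∃)
open import Data.Sum using (_⊎_)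
open import Relation.Binary.PropositionalEquality using (_≡_)

-- Exact comparisons of an integer x with the irrational n·√5 (n ≥ 0),
-- by squaring (valid since n·√5 ≥ 0).
-- x ≤ n√5
LeNSqrt5 : ℤ → ℕ → Set
LeNSqrt5 x n = (x ≤ + 0) ⊎ (x * x ≤ + 5 * (+ n * + n))

NSqrt5Lt : ℕ → ℤ → Set
NSqrt5Lt n x = (+ 0 < x) × (+ 5 * (+ n * + n) < x * x)

-- φ = (1+√5)/2.  IsFloorNφ n m  :⇔  m = ⌊n φ⌋, i.e. m ≤ n(1+√5)/2 < m+1,
-- i.e. 2m − n ≤ n√5 < 2(m+1) − n.
IsFloorNφ : ℕ → ℕ → Set
IsFloorNφ n m = LeNSqrt5 (+ 2 * + m - + n) n × NSqrt5Lt n (+ 2 * + (suc m) - + n)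

-- φ² = (3+√5)/2.  IsFloorNφ² n m  :⇔  m = ⌊n φ²⌋, i.e. 2m − 3n ≤ n√5 < 2(m+1) − 3n.
IsFloorNφ² : ℕ → ℕ → Set
IsFloorNφ² n m = LeNSqrt5 (+ 2 * + m - + 3 * + n) n × NSqrt5Lt n (+ 2 * + (suc m) - + 3 * + n)

InB : ℕ → Set
InB k = ∃ λ n → (1 ≤ℕ n) × IsFloorNφ² n k

InB+1 : ℕ → Set
InB+1 k = ∃ λ n → ∃ λ m → IsFloorNφ² n m × (k ≡ suc m)

InAB+1 : ℕ → Set
InAB+1 k = ∃ λ n → (1 ≤ℕ n) × ∃ λ m → IsFloorNφ n m × (k ≡ Data.Nat._+_ (Data.Nat._+_ (Data.Nat._*_ 2 m) n) 1)

module Submission where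

-- Let f(K) = ⌊K/φ²⌋ with φ² = (3 + √5)/2.  Since 2 < φ² < 3, f
-- increases by at most 1 per step and never at two consecutive steps.  Now
-- k = ⌊nφ²⌋ iff k/φ² < n < (k+1)/φ², i.e. iff f jumps from k to k + 1; so for
-- k ≥ 1 with a = f(k), exactly one of three things happens: f jumps right after
-- k (k ∈ B), right before k (k ∈ B+1; k = 1 comes from n = 0), or on neither
-- side.  In the last case a·φ² < k - 1 and k + 1 < (a + 1)·φ², and with
-- n = k - 1 - 2a the identity φ² = φ + 1 turns these into a ≤ nφ < a + 1, i.e.
-- k = 2⌊nφ⌋ + n + 1 ∈ AB+1; the same computations run backwards.
--
-- All comparisons with irrationals are made exactly in ℤ[√5].

open import Defs
open import Data.Nat using (ℕ; _≤_)
open import Data.Product using (_×_)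
open import Data.Sum using (_⊎_)
open import Relation.Nullary using (¬_)

open import Data.Nat as ℕ using (zero; suc; z≤n; s≤s; _<_)
import Data.Nat.Properties as ℕ
import Data.Nat.Tactic.RingSolver as ℕ-Solver
open import Data.Nat.Divisibility using (_∣_; divides)
open import Data.Nat.Induction using (<-rec)
open import Data.Nat.Primality using (prime?; euclidsLemma)
open import Data.Integer as ℤ using (ℤ; +_; -[1+_]; _+_; _-_; _*_; -_; ∣_∣; +<+; +≤+; -<-; -≤+)
  renaming (_<_ to _<ℤ_; _≤_ to _≤ℤ_)
import Data.Integer.Properties as ℤ
open import Data.Integer.Tactic.RingSolver using (solve)
open import Data.List using (_∷_; [])
open import Data.Product using (_,_; ∃; proj₁; proj₂)
open import Data.Sum using (inj₁; inj₂; [_,_]′)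
open import Data.Empty using (⊥; ⊥-elim)
open import Function using (id)
open import Relation.Binary using (Tri; tri<; tri≈; tri>)
open import Relation.Binary.PropositionalEquality
open import Relation.Nullary.Decidable using (from-yes)

square-cancel-< : ∀ m n → m ℕ.* m < n ℕ.* n → m < n
square-cancel-< m n m²<n² = ℕ.≰⇒> (λ n≤m → ℕ.<⇒≱ m²<n² (ℕ.*-mono-≤ n≤m n≤m))

5∣x²⇒5∣x : ∀ x → 5 ∣ x ℕ.* x → 5 ∣ x
5∣x²⇒5∣x x h = [ id , id ]′ (euclidsLemma x x (from-yes (prime? 5)) h)

√5-descent : ∀ y q → suc y ℕ.* suc y ≡ 5 ℕ.* (q ℕ.* q) → q < suc y
√5-descent y zero    _      = s≤s z≤n
√5-descent y (suc q) y²≡5q² = square-cancel-< (suc q) (suc y)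
  (subst (suc q ℕ.* suc q <_) (trans (ℕ.*-comm _ 5) (sym y²≡5q²)) (ℕ.m<m*n _ 5 (s≤s (s≤s z≤n))))

-- x² = 5y² has only the trivial solution, by infinite descent: x = 5q gives
-- y² = 5q² with q < y.  This is the irrationality of √5.
√5-irrationalℕ : ∀ y x → x ℕ.* x ≡ 5 ℕ.* (y ℕ.* y) → y ≡ 0
√5-irrationalℕ = <-rec _ descent
  where
  descent : ∀ y → (∀ {q} → q < y → ∀ x → x ℕ.* x ≡ 5 ℕ.* (q ℕ.* q) → q ≡ 0)
          → ∀ x → x ℕ.* x ≡ 5 ℕ.* (y ℕ.* y) → y ≡ 0
  descent zero    _   _ _ = refl
  descent (suc y) rec x x²≡5y² with 5∣x²⇒5∣x x (divides (suc y ℕ.* suc y) (trans x²≡5y² (ℕ.*-comm 5 _)))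
  ... | divides q refl = ⊥-elim (ℕ.1+n≢0 (subst (λ r → suc y ℕ.* suc y ≡ 5 ℕ.* (r ℕ.* r)) q≡0 y²≡5q²))
    where
    y²≡5q² : suc y ℕ.* suc y ≡ 5 ℕ.* (q ℕ.* q)
    y²≡5q² = ℕ.*-cancelˡ-≡ _ _ 5 (trans (sym x²≡5y²) (ℕ-Solver.solve (q ∷ [])))
    q<y : q < suc y
    q<y = √5-descent y q y²≡5q²
    q≡0 : q ≡ 0
    q≡0 = rec q<y (suc y) y²≡5q²

square-∣∣ : ∀ u → u * u ≡ + (∣ u ∣ ℕ.* ∣ u ∣)
square-∣∣ (+ n)    = sym (ℤ.pos-* n n)
square-∣∣ -[1+ n ] = refl

square-nonneg : ∀ u → + 0 ≤ℤ u * u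
square-nonneg u rewrite square-∣∣ u = +≤+ z≤n

5*square-nonneg : ∀ u → + 0 ≤ℤ + 5 * (u * u)
5*square-nonneg u = ℤ.*-monoˡ-≤-nonNeg (+ 5) (square-nonneg u)

square-zero : ∀ u → u * u ≡ + 0 → u ≡ + 0
square-zero u u²≡0 = ℤ.∣i∣≡0⇒i≡0 ([ id , id ]′ (ℕ.m*n≡0⇒m≡0∨n≡0 ∣ u ∣ (ℤ.+-injective (trans (sym (square-∣∣ u)) u²≡0))))

√5-irrational : ∀ x y → x * x ≡ + 5 * (y * y) → y ≡ + 0
√5-irrational x y x²≡5y² = ℤ.∣i∣≡0⇒i≡0 (√5-irrationalℕ ∣ y ∣ ∣ x ∣ (ℤ.+-injective (begin
  + (∣ x ∣ ℕ.* ∣ x ∣)      ≡⟨ sym (square-∣∣ x) ⟩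
  x * x                    ≡⟨ x²≡5y² ⟩
  + 5 * (y * y)            ≡⟨ cong (+ 5 *_) (square-∣∣ y) ⟩
  + 5 * + (∣ y ∣ ℕ.* ∣ y ∣) ≡⟨ sym (ℤ.pos-* 5 (∣ y ∣ ℕ.* ∣ y ∣)) ⟩
  + (5 ℕ.* (∣ y ∣ ℕ.* ∣ y ∣)) ∎)))
  where open ≡-Reasoning

<⇒0<- : ∀ {x y} → x <ℤ y → + 0 <ℤ y - x
<⇒0<- {x} {y} x<y = subst (_<ℤ y - x) (ℤ.+-inverseʳ x) (ℤ.+-monoˡ-< (- x) x<y)

0<-⇒< : ∀ {x y} → + 0 <ℤ y - x → x <ℤ y
0<-⇒< {x} {y} 0<y-x = subst₂ _<ℤ_ (ℤ.+-identityˡ x) y-x+x (ℤ.+-monoˡ-< x 0<y-x)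
  where
  y-x+x : y - x + x ≡ y
  y-x+x = solve (x ∷ y ∷ [])

*-pos : ∀ {x y} → + 0 <ℤ x → + 0 <ℤ y → + 0 <ℤ x * y
*-pos {+ x} {+ y} (+<+ 0<x) (+<+ 0<y) = subst (+ 0 <ℤ_) (ℤ.pos-* x y) (+<+ (ℕ.*-mono-< 0<x 0<y))

*-mono-<-nonNeg : ∀ {a b c d} → + 0 ≤ℤ b → b <ℤ a → + 0 ≤ℤ d → d <ℤ c → b * d <ℤ a * c
*-mono-<-nonNeg {+ a} {+ b} {+ c} {+ d} _ (+<+ b<a) _ (+<+ d<c) =
  subst₂ _<ℤ_ (ℤ.pos-* b d) (ℤ.pos-* a c) (+<+ (ℕ.*-mono-< b<a d<c))

-- If u² < v² with v ≥ 0, then |u| < v, hence u + v > 0.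
square-<⇒+-pos : ∀ u v → + 0 ≤ℤ v → u * u <ℤ v * v → + 0 <ℤ u + v
square-<⇒+-pos u (+ n) _ u²<v² = go u ∣u∣<n
  where
  ∣u∣<n : ∣ u ∣ < n
  ∣u∣<n = square-cancel-< ∣ u ∣ n (ℤ.drop‿+<+ (subst₂ _<ℤ_ (square-∣∣ u) (square-∣∣ (+ n)) u²<v²))
  go : ∀ u → ∣ u ∣ < n → + 0 <ℤ u + + n
  go (+ a)    a<n = +<+ (ℕ.<-≤-trans (ℕ.m<n⇒0<n a<n) (ℕ.m≤n+m n a))
  go -[1+ a ] a<n = subst (_<ℤ -[1+ a ] + + n) (ℤ.+-inverseˡ (+ n)) (ℤ.+-monoˡ-< (+ n) (lemma n a<n))
    where
    lemma : ∀ n → suc a < n → - + n <ℤ -[1+ a ]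
    lemma (suc n) a<n = -<- (ℕ.≤-pred a<n)

neg-difference : ∀ x y → - (x - y) ≡ y - x
neg-difference x y = solve (x ∷ y ∷ [])

¬pos-and-neg : ∀ x → + 0 <ℤ x → + 0 <ℤ - x → ⊥
¬pos-and-neg (+ zero)  (+<+ ()) _
¬pos-and-neg (+ suc n) _ ()

0<-⇒≤0 : ∀ x → + 0 <ℤ - x → x ≤ℤ + 0
0<-⇒≤0 (+ zero)  _  = +≤+ z≤n
0<-⇒≤0 (+ suc n) ()
0<-⇒≤0 -[1+ n ]  _  = -≤+

<0⇒0<- : ∀ x → x <ℤ + 0 → + 0 <ℤ - x
<0⇒0<- -[1+ n ] _        = +<+ (s≤s z≤n)
<0⇒0<- (+ n)    (+<+ ())

-- The positive cone of ℤ[√5]:  Pos p q  :⇔  p + q√5 > 0.  One of p, q√5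
-- dominates the other in absolute value, and the dominant one is positive.
data Pos (p q : ℤ) : Set where
  p-dominant   : + 0 <ℤ p → + 5 * (q * q) <ℤ p * p → Pos p q
  q√5-dominant : + 0 <ℤ q → p * p <ℤ + 5 * (q * q) → Pos p q

-- Transport along ring identities; the identity arguments come last so that
-- both of their sides are known when they are solved.
<-by : ∀ {a b a′ b′} → a <ℤ b → a ≡ a′ → b ≡ b′ → a′ <ℤ b′
<-by a<b refl refl = a<b

0<-by : ∀ {a a′} → + 0 <ℤ a → a ≡ a′ → + 0 <ℤ a′
0<-by 0<a refl = 0<a

pos-by : ∀ {p q p′ q′} → Pos p q → p ≡ p′ → q ≡ q′ → Pos p′ q′
pos-by h refl refl = h

pos-nonpos : ∀ {p q} → Pos p q → p ≤ℤ + 0 → q ≤ℤ + 0 → ⊥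
pos-nonpos (p-dominant 0<p _) p≤0 _   = ℤ.<⇒≱ 0<p p≤0
pos-nonpos (q√5-dominant 0<q _) _   q≤0 = ℤ.<⇒≱ 0<q q≤0

¬pos-zero : ¬ Pos (+ 0) (+ 0)
¬pos-zero h = pos-nonpos h (+≤+ z≤n) (+≤+ z≤n)

neg-square : ∀ x → (- x) * (- x) ≡ x * x
neg-square x = solve (x ∷ [])

pos-antisym : ∀ {p q} → Pos p q → Pos (- p) (- q) → ⊥
pos-antisym {p} {q} (p-dominant 0<p _) (p-dominant 0<-p _) = ¬pos-and-neg p 0<p 0<-p
pos-antisym {p} {q} (q√5-dominant 0<q _) (q√5-dominant 0<-q _) = ¬pos-and-neg q 0<q 0<-q
pos-antisym {p} {q} (p-dominant _ 5q²<p²) (q√5-dominant _ p²<5q²) =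
  ℤ.<-asym 5q²<p² (subst₂ (λ a b → a <ℤ + 5 * b) (neg-square p) (neg-square q) p²<5q²)
pos-antisym {p} {q} (q√5-dominant _ p²<5q²) (p-dominant _ 5q²<p²) =
  ℤ.<-asym p²<5q² (subst₂ (λ b a → + 5 * b <ℤ a) (neg-square q) (neg-square p) 5q²<p²)

-- Every element of ℤ[√5] is positive, negative or zero; the irrationality of √5
-- excludes p² = 5q² unless p = q = 0.
pos-trichotomy : ∀ p q → Pos p q ⊎ Pos (- p) (- q) ⊎ (p ≡ + 0 × q ≡ + 0)
pos-trichotomy p q with ℤ.<-cmp (p * p) (+ 5 * (q * q)) | ℤ.<-cmp (+ 0) p | ℤ.<-cmp (+ 0) q
... | tri≈ _ p²≡5q² _ | _ | _ = inj₂ (inj₂ (square-zero p (trans p²≡5q² (cong (λ y → + 5 * (y * y)) q≡0)) , q≡0))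
  where
  q≡0 : q ≡ + 0
  q≡0 = √5-irrational p q p²≡5q²
... | tri< p²<5q² _ _ | _ | tri< 0<q _ _ = inj₁ (q√5-dominant 0<q p²<5q²)
... | tri< p²<5q² _ _ | _ | tri≈ _ refl _ = ⊥-elim (ℤ.<⇒≱ p²<5q² (square-nonneg p))
... | tri< p²<5q² _ _ | _ | tri> _ _ q<0 =
  inj₂ (inj₁ (q√5-dominant (<0⇒0<- q q<0) (subst₂ (λ a b → a <ℤ + 5 * b) (sym (neg-square p)) (sym (neg-square q)) p²<5q²)))
... | tri> _ _ 5q²<p² | tri< 0<p _ _ | _ = inj₁ (p-dominant 0<p 5q²<p²)
... | tri> _ _ 5q²<p² | tri≈ _ refl _ | _ = ⊥-elim (ℤ.<⇒≱ 5q²<p² (5*square-nonneg q))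
... | tri> _ _ 5q²<p² | tri> _ _ p<0 | _ =
  inj₂ (inj₁ (p-dominant (<0⇒0<- p p<0) (subst₂ (λ b a → + 5 * b <ℤ a) (sym (neg-square q)) (sym (neg-square p)) 5q²<p²)))

pos-*-mixed : ∀ {p q r s} → + 0 <ℤ p → + 5 * (q * q) <ℤ p * p → + 0 <ℤ s → r * r <ℤ + 5 * (s * s)
            → Pos (p * r + + 5 * (q * s)) (p * s + q * r)
pos-*-mixed {p} {q} {r} {s} 0<p 5q²<p² 0<s r²<5s² = q√5-dominant irrational norm
  where
  5q²r²<5p²s² : + 5 * ((q * r) * (q * r)) <ℤ + 5 * ((p * s) * (p * s))
  5q²r²<5p²s² = <-by (*-mono-<-nonNeg (5*square-nonneg q) 5q²<p² (square-nonneg r) r²<5s²)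
    (solve (q ∷ r ∷ [])) (solve (p ∷ s ∷ []))
  irrational : + 0 <ℤ p * s + q * r
  irrational = subst (+ 0 <ℤ_) (ℤ.+-comm (q * r) (p * s))
    (square-<⇒+-pos (q * r) (p * s) (ℤ.<⇒≤ (*-pos 0<p 0<s)) (ℤ.*-cancelˡ-<-nonNeg (+ 5) 5q²r²<5p²s²))
  norm : (p * r + + 5 * (q * s)) * (p * r + + 5 * (q * s)) <ℤ + 5 * ((p * s + q * r) * (p * s + q * r))
  norm = 0<-⇒< (0<-by (*-pos (<⇒0<- 5q²<p²) (<⇒0<- r²<5s²)) (solve (p ∷ q ∷ r ∷ s ∷ [])))

-- The norm p² - 5q² is
-- multiplicative, which settles the comparison of squares; the sign of the
-- dominant part follows from the corresponding comparison of the factors.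
pos-* : ∀ {p q r s} → Pos p q → Pos r s → Pos (p * r + + 5 * (q * s)) (p * s + q * r)
pos-* {p} {q} {r} {s} (p-dominant 0<p 5q²<p²) (p-dominant 0<r 5s²<r²) = p-dominant rational norm
  where
  rational : + 0 <ℤ p * r + + 5 * (q * s)
  rational = subst (+ 0 <ℤ_) (ℤ.+-comm (+ 5 * (q * s)) (p * r)) (square-<⇒+-pos (+ 5 * (q * s)) (p * r) (ℤ.<⇒≤ (*-pos 0<p 0<r))
    (<-by (*-mono-<-nonNeg (5*square-nonneg q) 5q²<p² (5*square-nonneg s) 5s²<r²) (solve (q ∷ s ∷ [])) (solve (p ∷ r ∷ []))))
  norm : + 5 * ((p * s + q * r) * (p * s + q * r)) <ℤ (p * r + + 5 * (q * s)) * (p * r + + 5 * (q * s))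
  norm = 0<-⇒< (0<-by (*-pos (<⇒0<- 5q²<p²) (<⇒0<- 5s²<r²)) (solve (p ∷ q ∷ r ∷ s ∷ [])))
pos-* {p} {q} {r} {s} (p-dominant 0<p 5q²<p²) (q√5-dominant 0<s r²<5s²) = pos-*-mixed {p} {q} {r} {s} 0<p 5q²<p² 0<s r²<5s²
pos-* {p} {q} {r} {s} (q√5-dominant 0<q p²<5q²) (p-dominant 0<r 5s²<r²) =
  pos-by (pos-*-mixed {r} {s} {p} {q} 0<r 5s²<r² 0<q p²<5q²) rational irrational
  where
  rational : r * p + + 5 * (s * q) ≡ p * r + + 5 * (q * s)
  rational = solve (p ∷ q ∷ r ∷ s ∷ [])
  irrational : r * q + s * p ≡ p * s + q * r
  irrational = solve (p ∷ q ∷ r ∷ s ∷ [])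
pos-* {p} {q} {r} {s} (q√5-dominant 0<q p²<5q²) (q√5-dominant 0<s r²<5s²) = p-dominant rational norm
  where
  rational : + 0 <ℤ p * r + + 5 * (q * s)
  rational = square-<⇒+-pos (p * r) (+ 5 * (q * s)) (ℤ.<⇒≤ (*-pos {+ 5} (+<+ (s≤s z≤n)) (*-pos 0<q 0<s)))
    (<-by (*-mono-<-nonNeg (square-nonneg p) p²<5q² (square-nonneg r) r²<5s²) (solve (p ∷ r ∷ [])) (solve (q ∷ s ∷ [])))
  norm : + 5 * ((p * s + q * r) * (p * s + q * r)) <ℤ (p * r + + 5 * (q * s)) * (p * r + + 5 * (q * s))
  norm = 0<-⇒< (0<-by (*-pos (<⇒0<- p²<5q²) (<⇒0<- r²<5s²)) (solve (p ∷ q ∷ r ∷ s ∷ [])))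

pos-+-rational : ∀ {p q c} → Pos p q → + 0 <ℤ c → Pos (p + c) q
pos-+-rational {p} {q} {c} x>0 0<c = by-cases x>0 (ℤ.<-cmp ((p + c) * (p + c)) (+ 5 * (q * q)))
  where
  p<p+c : p <ℤ p + c
  p<p+c = subst (_<ℤ p + c) (ℤ.+-identityʳ p) (ℤ.+-monoʳ-< p 0<c)
  -- if p + c ≤ 0 then |p + c| < |p|, so (p + c)² < p²
  [p+c]²<p² : p + c ≤ℤ + 0 → (p + c) * (p + c) <ℤ p * p
  [p+c]²<p² p+c≤0 = <-by (*-mono-<-nonNeg (ℤ.neg-mono-≤ p+c≤0) (ℤ.neg-mono-< p<p+c) (ℤ.neg-mono-≤ p+c≤0) (ℤ.neg-mono-< p<p+c))
    (neg-square (p + c)) (neg-square p)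
  by-cases : Pos p q → Tri _ _ _ → Pos (p + c) q
  by-cases (p-dominant 0<p 5q²<p²) _ =
    p-dominant (ℤ.+-mono-< 0<p 0<c) (ℤ.<-trans 5q²<p² (*-mono-<-nonNeg (ℤ.<⇒≤ 0<p) p<p+c (ℤ.<⇒≤ 0<p) p<p+c))
  by-cases (q√5-dominant 0<q _) (tri< [p+c]²<5q² _ _) = q√5-dominant 0<q [p+c]²<5q²
  by-cases (q√5-dominant 0<q _) (tri≈ _ [p+c]²≡5q² _) = ⊥-elim (ℤ.<-irrefl (sym (√5-irrational (p + c) q [p+c]²≡5q²)) 0<q)
  by-cases (q√5-dominant _ p²<5q²) (tri> _ _ 5q²<[p+c]²) =
    p-dominant (ℤ.≰⇒> (λ p+c≤0 → ℤ.<-asym 5q²<[p+c]² (ℤ.<-trans ([p+c]²<p² p+c≤0) p²<5q²))) 5q²<[p+c]²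

pos-cancel : ∀ {x₁ x₂ y₁ y₂} → Pos x₁ x₂ → Pos (y₁ * x₁ + + 5 * (y₂ * x₂)) (y₁ * x₂ + y₂ * x₁) → Pos y₁ y₂
pos-cancel {x₁} {x₂} {y₁} {y₂} x>0 yx>0 with pos-trichotomy y₁ y₂
... | inj₁ y>0 = y>0
... | inj₂ (inj₁ -y>0) = ⊥-elim (pos-antisym yx>0 (pos-by (pos-* -y>0 x>0) rational irrational))
  where
  rational : (- y₁) * x₁ + + 5 * ((- y₂) * x₂) ≡ - (y₁ * x₁ + + 5 * (y₂ * x₂))
  rational = solve (x₁ ∷ x₂ ∷ y₁ ∷ y₂ ∷ [])
  irrational : (- y₁) * x₂ + (- y₂) * x₁ ≡ - (y₁ * x₂ + y₂ * x₁)
  irrational = solve (x₁ ∷ x₂ ∷ y₁ ∷ y₂ ∷ [])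
... | inj₂ (inj₂ (refl , refl)) = ⊥-elim (¬pos-zero yx>0)

-- Every positive x has a positive multiple x·c that is a positive integer:
-- c is ±(the Galois conjugate of x), the sign chosen to make c positive.
pos-conjugate : ∀ {p q} → Pos p q → ∃ λ c₁ → ∃ λ c₂ → ∃ λ N → Pos c₁ c₂ × + 0 <ℤ N
              × (p * c₁ + + 5 * (q * c₂) ≡ N) × (p * c₂ + q * c₁ ≡ + 0)
pos-conjugate {p} {q} (p-dominant 0<p 5q²<p²) =
  p , - q , p * p - + 5 * (q * q) ,
  p-dominant 0<p (subst (λ y → + 5 * y <ℤ p * p) (sym (neg-square q)) 5q²<p²) , <⇒0<- 5q²<p² ,
  solve (p ∷ q ∷ []) , solve (p ∷ q ∷ [])
pos-conjugate {p} {q} (q√5-dominant 0<q p²<5q²) =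
  - p , q , + 5 * (q * q) - p * p ,
  q√5-dominant 0<q (subst (_<ℤ + 5 * (q * q)) (sym (neg-square p)) p²<5q²) , <⇒0<- p²<5q² ,
  solve (p ∷ q ∷ []) , solve (p ∷ q ∷ [])

-- The positive cone is closed under addition: with c as above,
-- (x + y)·c = N + y·c > 0, and c > 0 can be cancelled.
pos-+ : ∀ {p q r s} → Pos p q → Pos r s → Pos (p + r) (q + s)
pos-+ {p} {q} {r} {s} x>0 y>0 with pos-conjugate x>0
... | c₁ , c₂ , N , c>0 , 0<N , xc≡N , xc-irrational≡0 =
  pos-cancel c>0 (pos-by (pos-+-rational (pos-* y>0 c>0) 0<N) rational irrational)
  where
  rational : (r * c₁ + + 5 * (s * c₂)) + N ≡ (p + r) * c₁ + + 5 * ((q + s) * c₂)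
  rational = begin
    (r * c₁ + + 5 * (s * c₂)) + N                              ≡⟨ cong (λ z → (r * c₁ + + 5 * (s * c₂)) + z) (sym xc≡N) ⟩
    (r * c₁ + + 5 * (s * c₂)) + (p * c₁ + + 5 * (q * c₂))      ≡⟨ solve (p ∷ q ∷ r ∷ s ∷ c₁ ∷ c₂ ∷ []) ⟩
    (p + r) * c₁ + + 5 * ((q + s) * c₂)                        ∎
    where open ≡-Reasoning
  irrational : r * c₂ + s * c₁ ≡ (p + r) * c₂ + (q + s) * c₁
  irrational = begin
    r * c₂ + s * c₁                               ≡⟨ sym (ℤ.+-identityʳ _) ⟩
    (r * c₂ + s * c₁) + + 0                       ≡⟨ cong (λ z → (r * c₂ + s * c₁) + z) (sym xc-irrational≡0) ⟩
    (r * c₂ + s * c₁) + (p * c₂ + q * c₁)         ≡⟨ solve (p ∷ q ∷ r ∷ s ∷ c₁ ∷ c₂ ∷ []) ⟩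
    (p + r) * c₂ + (q + s) * c₁                   ∎
    where open ≡-Reasoning

pos-half : ∀ {p q} → Pos (+ 2 * p) (+ 2 * q) → Pos p q
pos-half {p} {q} 2x>0 = pos-cancel {+ 2} {+ 0} 2>0 (pos-by 2x>0 rational irrational)
  where
  2>0 : Pos (+ 2) (+ 0)
  2>0 = p-dominant (+<+ (s≤s z≤n)) (+<+ (s≤s z≤n))
  rational : + 2 * p ≡ p * + 2 + + 5 * (q * + 0)
  rational = solve (p ∷ q ∷ [])
  irrational : + 2 * q ≡ p * + 0 + q * + 2
  irrational = solve (p ∷ q ∷ [])

pos-integer : ∀ {c} → + 0 <ℤ c → Pos c (+ 0)
pos-integer 0<c = p-dominant 0<c (*-pos 0<c 0<c)

-- Comparison of a multiple A·φ² = A(3+√5)/2 with an integer K: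
--   A φ²< K  :⇔  A·φ² < K,  i.e. (2K - 3A) - A√5 > 0,
--   A φ²> K  :⇔  A·φ² > K,  i.e. (3A - 2K) + A√5 > 0.
infix 4 _φ²<_ _φ²>_

_φ²<_ : ℤ → ℤ → Set
A φ²< K = Pos (+ 2 * K - + 3 * A) (- A)

_φ²>_ : ℤ → ℤ → Set
A φ²> K = Pos (+ 3 * A - + 2 * K) A

φ²<-φ²>-exclusive : ∀ {A K} → A φ²< K → A φ²> K → ⊥
φ²<-φ²>-exclusive {A} {K} A·φ²<K A·φ²>K = pos-antisym A·φ²>K (pos-by A·φ²<K (sym (neg-difference (+ 3 * A) (+ 2 * K))) refl)

-- Since φ² is irrational, A·φ² = K only for A = K = 0.
φ²-compare : ∀ A K → A φ²< K ⊎ A φ²> K ⊎ (A ≡ + 0 × K ≡ + 0)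
φ²-compare A K with pos-trichotomy (+ 3 * A - + 2 * K) A
... | inj₁ A·φ²>K           = inj₂ (inj₁ A·φ²>K)
... | inj₂ (inj₁ A·φ²<K)    = inj₁ (pos-by A·φ²<K (neg-difference (+ 3 * A) (+ 2 * K)) refl)
... | inj₂ (inj₂ (3A-2K≡0 , refl)) = inj₂ (inj₂ (refl , ℤ.*-cancelˡ-≡ (+ 2) K (+ 0) 2K≡0))
  where
  2K≡0 : + 2 * K ≡ + 2 * + 0
  2K≡0 = begin
    + 2 * K                          ≡⟨ solve (K ∷ []) ⟩
    - (+ 3 * + 0 - + 2 * K)          ≡⟨ cong -_ 3A-2K≡0 ⟩
    + 0                              ∎
    where open ≡-Reasoning

φ²<-suc : ∀ {A K} → A φ²< K → A φ²< + 1 + K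
φ²<-suc {A} {K} A·φ²<K = pos-by (pos-+ A·φ²<K (pos-integer {+ 2} (+<+ (s≤s z≤n)))) (solve (A ∷ K ∷ [])) (solve (A ∷ []))

φ²>-pred : ∀ {A K} → A φ²> + 1 + K → A φ²> K
φ²>-pred {A} {K} A·φ²>K+1 = pos-by (pos-+ A·φ²>K+1 (pos-integer {+ 2} (+<+ (s≤s z≤n)))) (solve (A ∷ K ∷ [])) (solve (A ∷ []))

-- 2φ = 1 + √5 > 0, i.e. φ² > 1.
2φ>0 : Pos (+ 1) (+ 1)
2φ>0 = q√5-dominant (+<+ (s≤s z≤n)) (+<+ (s≤s (s≤s z≤n)))

-- Since φ² > 1, A·φ² < K persists when A and K both decrease by 1,
-- and A·φ² > K when both increase by 1.
φ²<-pred : ∀ {A K} → + 1 + A φ²< + 1 + K → A φ²< K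
φ²<-pred {A} {K} h = pos-by (pos-+ h 2φ>0) (solve (A ∷ K ∷ [])) (solve (A ∷ []))

φ²>-suc : ∀ {A K} → A φ²> K → + 1 + A φ²> + 1 + K
φ²>-suc {A} {K} h = pos-by (pos-+ h 2φ>0) (solve (A ∷ K ∷ [])) (solve (A ∷ []))

-- φ² > 2, and consequently K ↦ ⌊K/φ²⌋ never increases twice in a row:
-- A·φ² > K and (A + 1)·φ² < K + 2 would give φ² < 2.
φ²>2 : + 1 φ²> + 2
φ²>2 = q√5-dominant (+<+ (s≤s z≤n)) (+<+ (s≤s (s≤s z≤n)))

no-double-jump : ∀ {A K} → A φ²> K → + 1 + A φ²< + 2 + K → ⊥
no-double-jump {A} {K} A·φ²>K [A+1]·φ²<K+2 =
  φ²<-φ²>-exclusive {+ 1} {+ 2} (pos-by (pos-+ A·φ²>K [A+1]·φ²<K+2) (solve (A ∷ K ∷ [])) (solve (A ∷ []))) φ²>2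

¬φ²<0 : ∀ a → ¬ (+ a φ²< + 0)
¬φ²<0 a a·φ²<0 = pos-nonpos a·φ²<0 (ℤ.i≤j⇒i-j≤0 (subst (+ 0 ≤ℤ_) (ℤ.pos-* 3 a) (+≤+ z≤n))) (ℤ.neg-mono-≤ (+≤+ z≤n))

FloorDivφ² : ℤ → ℕ → Set
FloorDivφ² K a = + a φ²< K × + suc a φ²> K

-- A·φ² < K < B·φ² forces A < B: adding the two inequalities gives
-- (B - A)(3 + √5) > 0.
φ²<-φ²>-< : ∀ {K A B} → A φ²< K → B φ²> K → A <ℤ B
φ²<-φ²>-< {K} {A} {B} A·φ²<K K<B·φ² = 0<-⇒< 0<B-A
  where
  [B-A][3+√5]>0 : Pos (+ 3 * (B - A)) (B - A)
  [B-A][3+√5]>0 = pos-by (pos-+ A·φ²<K K<B·φ²) (solve (K ∷ A ∷ B ∷ [])) (solve (A ∷ B ∷ []))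
  0<B-A : + 0 <ℤ B - A
  0<B-A = ℤ.≰⇒> (λ B-A≤0 → pos-nonpos [B-A][3+√5]>0 (ℤ.*-monoˡ-≤-nonNeg (+ 3) B-A≤0) B-A≤0)

FloorDivφ²-unique : ∀ {K a b} → FloorDivφ² K a → FloorDivφ² K b → a ≡ b
FloorDivφ²-unique {K} (a·φ²<K , K<[a+1]·φ²) (b·φ²<K , K<[b+1]·φ²) =
  ℕ.≤-antisym (ℕ.≤-pred (ℤ.drop‿+<+ (φ²<-φ²>-< {K} a·φ²<K K<[b+1]·φ²)))
              (ℕ.≤-pred (ℤ.drop‿+<+ (φ²<-φ²>-< {K} b·φ²<K K<[a+1]·φ²)))

switch-point : {P Q : ℕ → Set} → (∀ a → P a ⊎ Q a) → ∀ k → P 0 → Q (suc k) → ∃ λ a → P a × Q (suc a)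
switch-point dec zero    p₀ q₁   = 0 , p₀ , q₁
switch-point dec (suc k) p₀ qₖ₊₂ with dec (suc k)
... | inj₁ pₖ₊₁ = suc k , pₖ₊₁ , qₖ₊₂
... | inj₂ qₖ₊₁ = switch-point dec k p₀ qₖ₊₁

0·φ²< : ∀ {K} → + 0 <ℤ K → + 0 φ²< K
0·φ²< {K} 0<K = pos-by (pos-integer (ℤ.*-monoˡ-<-pos (+ 2) 0<K)) 2K≡2K-3·0 refl
  where
  2K≡2K-3·0 : + 2 * K ≡ + 2 * K - + 3 * + 0
  2K≡2K-3·0 = solve (K ∷ [])

<·φ² : ∀ {K} → + 0 <ℤ K → K φ²> K
<·φ² {K} 0<K = pos-by (pos-* (pos-integer 0<K) 2φ>0) (solve (K ∷ [])) (solve (K ∷ []))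

-- Every positive K has a floor ⌊K/φ²⌋, found between 0 and K since each
-- a·φ² lies strictly on one side of K by irrationality.
FloorDivφ²-exists : ∀ m → ∃ (FloorDivφ² (+ suc m))
FloorDivφ²-exists m = switch-point compare m (0·φ²< 0<K) (<·φ² 0<K)
  where
  0<K : + 0 <ℤ + suc m
  0<K = +<+ (s≤s z≤n)
  compare : ∀ a → + a φ²< + suc m ⊎ + a φ²> + suc m
  compare a with φ²-compare (+ a) (+ suc m)
  ... | inj₁ a·φ²<K            = inj₁ a·φ²<K
  ... | inj₂ (inj₁ a·φ²>K)     = inj₂ a·φ²>K
  ... | inj₂ (inj₂ (_ , ()))

-- The comparisons of Defs between an integer x and n√5, read in ℤ[√5]:
-- x ≤ n√5 means n√5 - x > 0 (for n ≥ 1 equality is impossible), and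
-- n√5 < x means x - n√5 > 0.
≤n√5⇒pos : ∀ x n → LeNSqrt5 x (suc n) → Pos (- x) (+ suc n)
≤n√5⇒pos x n x≤n√5 with ℤ.<-cmp (x * x) (+ 5 * (+ suc n * + suc n))
... | tri< x²<5n² _ _ = q√5-dominant (+<+ (s≤s z≤n)) (subst (_<ℤ _) (sym (neg-square x)) x²<5n²)
... | tri≈ _ x²≡5n² _ = ⊥-elim (ℕ.1+n≢0 (ℤ.+-injective (√5-irrational x (+ suc n) x²≡5n²)))
... | tri> _ _ 5n²<x² with x≤n√5 | ℤ.<-cmp x (+ 0)
...   | inj₂ x²≤5n² | _             = ⊥-elim (ℤ.<⇒≱ 5n²<x² x²≤5n²)
...   | inj₁ _      | tri< x<0 _ _  = p-dominant (<0⇒0<- x x<0) (subst (_ <ℤ_) (sym (neg-square x)) 5n²<x²)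
...   | inj₁ _      | tri≈ _ refl _ = ⊥-elim (ℤ.<⇒≱ 5n²<x² (5*square-nonneg (+ suc n)))
...   | inj₁ x≤0    | tri> _ _ 0<x  = ⊥-elim (ℤ.<⇒≱ 0<x x≤0)

pos⇒≤n√5 : ∀ x n → Pos (- x) (+ n) → LeNSqrt5 x n
pos⇒≤n√5 x n (p-dominant 0<-x _)     = inj₁ (0<-⇒≤0 x 0<-x)
pos⇒≤n√5 x n (q√5-dominant _ x²<5n²) = inj₂ (ℤ.<⇒≤ (subst (_<ℤ _) (neg-square x) x²<5n²))

n√5<⇒pos : ∀ n x → NSqrt5Lt n x → Pos x (- + n)
n√5<⇒pos n x (0<x , 5n²<x²) = p-dominant 0<x (subst (λ y → + 5 * y <ℤ x * x) (sym (neg-square (+ n))) 5n²<x²)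

pos⇒n√5< : ∀ n x → Pos x (- + n) → NSqrt5Lt n x
pos⇒n√5< n x (p-dominant 0<x 5n²<x²) = 0<x , subst (λ y → + 5 * y <ℤ x * x) (neg-square (+ n)) 5n²<x²
pos⇒n√5< n x (q√5-dominant 0<-n _)   = ⊥-elim (ℤ.<⇒≱ 0<-n (ℤ.neg-mono-≤ (+≤+ z≤n)))

≤0√5⇒≤0 : ∀ x → LeNSqrt5 x 0 → x ≤ℤ + 0
≤0√5⇒≤0 x (inj₁ x≤0)  = x≤0
≤0√5⇒≤0 x (inj₂ x²≤0) = ℤ.≤-reflexive (square-zero x (ℤ.≤-antisym x²≤0 (square-nonneg x)))

IsFloorNφ²⇒ : ∀ {n m} → IsFloorNφ² (suc n) m → + suc n φ²> + m × + suc n φ²< + suc m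
IsFloorNφ²⇒ {n} {m} (lower , upper) =
  pos-by (≤n√5⇒pos _ n lower) (neg-difference (+ 2 * + m) (+ 3 * + suc n)) refl , n√5<⇒pos (suc n) _ upper

⇒IsFloorNφ² : ∀ {n m} → + n φ²> + m → + n φ²< + suc m → IsFloorNφ² n m
⇒IsFloorNφ² {n} {m} m<n·φ² n·φ²<m+1 =
  pos⇒≤n√5 _ n (pos-by m<n·φ² (sym (neg-difference (+ 2 * + m) (+ 3 * + n))) refl) , pos⇒n√5< n _ n·φ²<m+1

IsFloorNφ²-zero : ∀ {m} → IsFloorNφ² 0 m → m ≡ 0
IsFloorNφ²-zero {m} (lower , _) = ℕ.n≤0⇒n≡0 (ℕ.≤-trans (ℕ.m≤n*m m 2) (ℤ.drop‿+≤+ 2m≤0))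
  where
  2m≤0 : + (2 ℕ.* m) ≤ℤ + 0
  2m≤0 = subst (_≤ℤ + 0) (trans (ℤ.+-identityʳ (+ 2 * + m)) (sym (ℤ.pos-* 2 m))) (≤0√5⇒≤0 _ lower)

pos-*-half : ∀ {p q r s P Q} → Pos p q → Pos r s
           → p * r + + 5 * (q * s) ≡ + 2 * P → p * s + q * r ≡ + 2 * Q → Pos P Q
pos-*-half x>0 y>0 rational irrational = pos-half (pos-by (pos-* x>0 y>0) rational irrational)

-- 2/φ = √5 - 1 > 0.
2/φ>0 : Pos (- + 1) (+ 1)
2/φ>0 = q√5-dominant (+<+ (s≤s z≤n)) (+<+ (s≤s (s≤s z≤n)))

-- Let S = 2A + N.  Multiplying by φ or 1/φ, and using φ² = φ + 1:
--   A < N·φ      ⇔  A·φ² < S,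
--   N·φ < A + 1  ⇔  S + 2 < (A + 1)·φ².
-- In ℤ[√5], A < N·φ reads (N - 2A) + N√5 > 0 and N·φ < A + 1 reads
-- (2(A + 1) - N) - N√5 > 0.
φ-lower⇒ : ∀ {A N} → Pos (N - + 2 * A) N → A φ²< + 2 * A + N
φ-lower⇒ {A} {N} A<Nφ = pos-*-half A<Nφ 2/φ>0 (solve (A ∷ N ∷ [])) (solve (A ∷ N ∷ []))

φ-lower⇐ : ∀ {A N} → A φ²< + 2 * A + N → Pos (N - + 2 * A) N
φ-lower⇐ {A} {N} A·φ²<S = pos-*-half A·φ²<S 2φ>0 (solve (A ∷ N ∷ [])) (solve (A ∷ N ∷ []))

φ-upper⇒ : ∀ {A N} → Pos (+ 2 * (+ 1 + A) - N) (- N) → + 1 + A φ²> + 2 + (+ 2 * A + N)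
φ-upper⇒ {A} {N} Nφ<A+1 = pos-*-half Nφ<A+1 2/φ>0 (solve (A ∷ N ∷ [])) (solve (A ∷ N ∷ []))

φ-upper⇐ : ∀ {A N} → + 1 + A φ²> + 2 + (+ 2 * A + N) → Pos (+ 2 * (+ 1 + A) - N) (- N)
φ-upper⇐ {A} {N} S+2<[A+1]·φ² = pos-*-half S+2<[A+1]·φ² 2φ>0 (solve (A ∷ N ∷ [])) (solve (A ∷ N ∷ []))

embed : ∀ a n → + (2 ℕ.* a ℕ.+ n) ≡ + 2 * + a + + n
embed a n = trans (ℤ.pos-+ (2 ℕ.* a) n) (cong (_+ + n) (ℤ.pos-* 2 a))

IsFloorNφ⇒ : ∀ {n a} → IsFloorNφ (suc n) a
           → + a φ²< + (2 ℕ.* a ℕ.+ suc n) × + suc a φ²> + 2 + + (2 ℕ.* a ℕ.+ suc n)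
IsFloorNφ⇒ {n} {a} (lower , upper) =
  subst (+ a φ²<_) (sym (embed a (suc n)))
    (φ-lower⇒ {+ a} (pos-by (≤n√5⇒pos _ n lower) (neg-difference (+ 2 * + a) (+ suc n)) refl)) ,
  subst (λ S → + suc a φ²> + 2 + S) (sym (embed a (suc n))) (φ-upper⇒ {+ a} (n√5<⇒pos (suc n) _ upper))

⇒IsFloorNφ : ∀ {n a} → + a φ²< + (2 ℕ.* a ℕ.+ n) → + suc a φ²> + 2 + + (2 ℕ.* a ℕ.+ n) → IsFloorNφ n a
⇒IsFloorNφ {n} {a} lower upper =
  pos⇒≤n√5 _ n (pos-by (φ-lower⇐ {+ a} (subst (+ a φ²<_) (embed a n) lower)) (sym (neg-difference (+ 2 * + a) (+ n))) refl) ,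
  pos⇒n√5< n _ (φ-upper⇐ {+ a} (subst (λ S → + suc a φ²> + 2 + S) (embed a n) upper))

-- a·φ² < m forces m = 2a + n with n ≥ 1: by φ-lower⇐, N = m - 2a satisfies
-- (N - 2a) + N√5 > 0, so N > 0.
φ²<⇒decomposition : ∀ {a m} → + a φ²< + m → ∃ λ n → m ≡ 2 ℕ.* a ℕ.+ suc n
φ²<⇒decomposition {a} {m} a·φ²<m = m ℕ.∸ suc (2 ℕ.* a) , sym (trans (ℕ.+-suc _ _) (ℕ.m+[n∸m]≡n 2a<m))
  where
  N : ℤ
  N = + m - + 2 * + a
  split : ∀ M A → M ≡ + 2 * A + (M - + 2 * A)
  split M A = solve (M ∷ A ∷ [])
  [N-2a]+N√5>0 : Pos (N - + 2 * + a) N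
  [N-2a]+N√5>0 = φ-lower⇐ {+ a} (subst (+ a φ²<_) (split (+ m) (+ a)) a·φ²<m)
  N-2a≤N : N - + 2 * + a ≤ℤ N
  N-2a≤N = subst (λ t → N - t ≤ℤ N) (ℤ.pos-* 2 a) (ℤ.i-j≤i N (+ (2 ℕ.* a)))
  0<N : + 0 <ℤ N
  0<N = ℤ.≰⇒> (λ N≤0 → pos-nonpos [N-2a]+N√5>0 (ℤ.≤-trans N-2a≤N N≤0) N≤0)
  2a<m : 2 ℕ.* a < m
  2a<m = ℤ.drop‿+<+ (subst (_<ℤ + m) (sym (ℤ.pos-* 2 a)) (0<-⇒< 0<N))

-- Where k sits relative to the jumps of K ↦ ⌊K/φ²⌋, given a = ⌊k/φ²⌋:
-- the floor jumps right after k, right before k, or on neither side.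
-- These three positions characterise B, B+1 and AB+1 respectively.
Located : ℤ → (ℕ → Set) → Set
Located K Position = ∃ λ a → FloorDivφ² K a × Position a

-- ⌊(k + 1)/φ²⌋ = a + 1.
JumpAfter : ℕ → ℕ → Set
JumpAfter k a = + suc a φ²< + suc k

-- For k = m + 1:  ⌊m/φ²⌋ = a - 1, or else k = 1 (the member of B+1 from n = 0).
JumpBefore : ℕ → ℕ → Set
JumpBefore m a = + a φ²> + m ⊎ (m ≡ 0 × a ≡ 0)

-- For k = m + 1:  ⌊m/φ²⌋ = ⌊(m + 2)/φ²⌋ = a.
NoJump : ℕ → ℕ → Set
NoJump m a = + a φ²< + m × + suc a φ²> + 2 + + m

same-floor : ∀ {K P Q} → Located K P → Located K Q → ∃ λ a → P a × Q a
same-floor {K} {P} {Q} (a , floor-a , Pa) (b , floor-b , Qb) =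
  a , Pa , subst Q (sym (FloorDivφ²-unique {K} floor-a floor-b)) Qb

-- k ∈ B  ⇔  the floor jumps right after k  (with n = a + 1).
InB⇒JumpAfter : ∀ {k} → InB k → Located (+ k) (JumpAfter k)
InB⇒JumpAfter {k} (suc a , _ , isFloor) = a , (φ²<-pred {+ a} {+ k} [a+1]·φ²<k+1 , k<[a+1]·φ²) , [a+1]·φ²<k+1
  where
  k<[a+1]·φ² : + suc a φ²> + k
  k<[a+1]·φ² = proj₁ (IsFloorNφ²⇒ isFloor)
  [a+1]·φ²<k+1 : + suc a φ²< + suc k
  [a+1]·φ²<k+1 = proj₂ (IsFloorNφ²⇒ isFloor)

JumpAfter⇒InB : ∀ {k} → Located (+ k) (JumpAfter k) → InB k
JumpAfter⇒InB (a , (_ , k<[a+1]·φ²) , [a+1]·φ²<k+1) = suc a , s≤s z≤n , ⇒IsFloorNφ² k<[a+1]·φ² [a+1]·φ²<k+1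

-- k ∈ B+1  ⇔  the floor jumps right before k  (with n = a).
InB+1⇒JumpBefore : ∀ {m} → InB+1 (suc m) → Located (+ suc m) (JumpBefore m)
InB+1⇒JumpBefore (zero , m , isFloor , refl) =
  subst (λ m → Located (+ suc m) (JumpBefore m)) (sym (IsFloorNφ²-zero isFloor))
    (0 , (0·φ²< {+ 1} (+<+ (s≤s z≤n)) , <·φ² {+ 1} (+<+ (s≤s z≤n))) , inj₂ (refl , refl))
InB+1⇒JumpBefore (suc n , m , isFloor , refl) =
  suc n , ([n+1]·φ²<m+1 , φ²>-suc {+ suc n} {+ m} m<[n+1]·φ²) , inj₁ m<[n+1]·φ²
  where
  m<[n+1]·φ² : + suc n φ²> + m
  m<[n+1]·φ² = proj₁ (IsFloorNφ²⇒ isFloor)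
  [n+1]·φ²<m+1 : + suc n φ²< + suc m
  [n+1]·φ²<m+1 = proj₂ (IsFloorNφ²⇒ isFloor)

JumpBefore⇒InB+1 : ∀ {m} → Located (+ suc m) (JumpBefore m) → InB+1 (suc m)
JumpBefore⇒InB+1 {m} (a , (a·φ²<m+1 , _) , inj₁ m<a·φ²) = a , m , ⇒IsFloorNφ² m<a·φ² a·φ²<m+1 , refl
JumpBefore⇒InB+1 (_ , _ , inj₂ (refl , refl)) = 0 , 0 , ⌊0·φ²⌋≡0 , refl
  where
  ⌊0·φ²⌋≡0 : IsFloorNφ² 0 0
  ⌊0·φ²⌋≡0 = inj₁ (+≤+ z≤n) , +<+ (s≤s z≤n) , +<+ (s≤s z≤n)

NoJump⇒floor : ∀ {m a} → NoJump m a → FloorDivφ² (+ suc m) a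
NoJump⇒floor {m} {a} (a·φ²<m , m+2<[a+1]·φ²) = φ²<-suc {+ a} {+ m} a·φ²<m , φ²>-pred {+ suc a} {+ suc m} m+2<[a+1]·φ²

-- k ∈ AB+1  ⇔  the floor jumps on neither side of k  (with n = k - 1 - 2a).
InAB+1⇒NoJump : ∀ {m} → InAB+1 (suc m) → Located (+ suc m) (NoJump m)
InAB+1⇒NoJump {m} (suc n , _ , a , isFloor , k≡S+1) = a , NoJump⇒floor position , position
  where
  m≡S : m ≡ 2 ℕ.* a ℕ.+ suc n
  m≡S = ℕ.suc-injective (trans k≡S+1 (ℕ.+-comm _ 1))
  position : NoJump m a
  position = subst (λ S → NoJump S a) (sym m≡S) (IsFloorNφ⇒ isFloor)

NoJump⇒InAB+1 : ∀ {m} → Located (+ suc m) (NoJump m) → InAB+1 (suc m)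
NoJump⇒InAB+1 {m} (a , _ , position) =
  suc n , s≤s z≤n , a , ⇒IsFloorNφ (proj₁ position′) (proj₂ position′) , trans (cong suc m≡S) (ℕ.+-comm 1 (2 ℕ.* a ℕ.+ suc n))
  where
  n : ℕ
  n = proj₁ (φ²<⇒decomposition {a} {m} (proj₁ position))
  m≡S : m ≡ 2 ℕ.* a ℕ.+ suc n
  m≡S = proj₂ (φ²<⇒decomposition {a} {m} (proj₁ position))
  position′ : NoJump (2 ℕ.* a ℕ.+ suc n) a
  position′ = subst (λ S → NoJump S a) m≡S position

JumpAfter-JumpBefore : ∀ {m} → ¬ (∃ λ a → JumpAfter (suc m) a × JumpBefore m a)
JumpAfter-JumpBefore {m} (a , [a+1]·φ²<m+2 , inj₁ m<a·φ²) = no-double-jump {+ a} {+ m} m<a·φ² [a+1]·φ²<m+2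
JumpAfter-JumpBefore (_ , 1·φ²<2 , inj₂ (refl , refl)) = φ²<-φ²>-exclusive {+ 1} {+ 2} 1·φ²<2 φ²>2

JumpAfter-NoJump : ∀ {m} → ¬ (∃ λ a → JumpAfter (suc m) a × NoJump m a)
JumpAfter-NoJump {m} (a , [a+1]·φ²<m+2 , _ , m+2<[a+1]·φ²) =
  φ²<-φ²>-exclusive {+ suc a} {+ suc (suc m)} [a+1]·φ²<m+2 m+2<[a+1]·φ²

JumpBefore-NoJump : ∀ {m} → ¬ (∃ λ a → JumpBefore m a × NoJump m a)
JumpBefore-NoJump {m} (a , inj₁ m<a·φ² , a·φ²<m , _) = φ²<-φ²>-exclusive {+ a} {+ m} a·φ²<m m<a·φ²
JumpBefore-NoJump (_ , inj₂ (refl , refl) , 0·φ²<0 , _) = ¬φ²<0 0 0·φ²<0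

cover : ∀ k → 1 ≤ k → InB k ⊎ (InB+1 k ⊎ InAB+1 k)
cover (suc m) _ = compare-neighbours (FloorDivφ²-exists m)
  where
  compare-neighbours : ∃ (FloorDivφ² (+ suc m)) → InB (suc m) ⊎ (InB+1 (suc m) ⊎ InAB+1 (suc m))
  compare-neighbours (a , floor) with φ²-compare (+ suc a) (+ suc (suc m)) | φ²-compare (+ a) (+ m)
  ... | inj₁ [a+1]·φ²<k+1        | _                         = inj₁ (JumpAfter⇒InB {suc m} (a , floor , [a+1]·φ²<k+1))
  ... | inj₂ (inj₂ (() , _))     | _
  ... | inj₂ (inj₁ _)            | inj₂ (inj₁ m<a·φ²)        = inj₂ (inj₁ (JumpBefore⇒InB+1 {m} (a , floor , inj₁ m<a·φ²)))
  ... | inj₂ (inj₁ _)            | inj₂ (inj₂ (refl , refl)) = inj₂ (inj₁ (JumpBefore⇒InB+1 {m} (0 , floor , inj₂ (refl , refl))))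
  ... | inj₂ (inj₁ k+1<[a+1]·φ²) | inj₁ a·φ²<m               = inj₂ (inj₂ (NoJump⇒InAB+1 {m} (a , floor , a·φ²<m , k+1<[a+1]·φ²)))

¬InB-zero : ¬ InB 0
¬InB-zero inB with InB⇒JumpAfter {0} inB
... | a , (a·φ²<0 , _) , _ = ¬φ²<0 a a·φ²<0

members-positive : ∀ k → InB k ⊎ (InB+1 k ⊎ InAB+1 k) → 1 ≤ k
members-positive zero    (inj₁ inB) = ⊥-elim (¬InB-zero inB)
members-positive (suc _) (inj₁ _)   = s≤s z≤n
members-positive _ (inj₂ (inj₁ (_ , _ , _ , refl))) = s≤s z≤n
members-positive _ (inj₂ (inj₂ (_ , _ , _ , _ , k≡S+1))) = subst (1 ≤_) (sym k≡S+1) (ℕ.m≤n+m 1 _)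

B∩B+1 : ∀ k → ¬ (InB k × InB+1 k)
B∩B+1 zero    (_ , (_ , _ , _ , ()))
B∩B+1 (suc m) (inB , inB+1) = JumpAfter-JumpBefore (same-floor {+ suc m} (InB⇒JumpAfter {suc m} inB) (InB+1⇒JumpBefore {m} inB+1))

B∩AB+1 : ∀ k → ¬ (InB k × InAB+1 k)
B∩AB+1 zero    (inB , _)        = ¬InB-zero inB
B∩AB+1 (suc m) (inB , inAB+1) = JumpAfter-NoJump (same-floor {+ suc m} (InB⇒JumpAfter {suc m} inB) (InAB+1⇒NoJump {m} inAB+1))

B+1∩AB+1 : ∀ k → ¬ (InB+1 k × InAB+1 k)
B+1∩AB+1 zero    ((_ , _ , _ , ()) , _)
B+1∩AB+1 (suc m) (inB+1 , inAB+1) = JumpBefore-NoJump (same-floor {+ suc m} (InB+1⇒JumpBefore {m} inB+1) (InAB+1⇒NoJump {m} inAB+1))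

lemma1 : ((k : ℕ) → 1 ≤ k → InB k ⊎ (InB+1 k ⊎ InAB+1 k))
         × ((k : ℕ) → InB k ⊎ (InB+1 k ⊎ InAB+1 k) → 1 ≤ k)
         × ((k : ℕ) → ¬ (InB k × InB+1 k))
         × ((k : ℕ) → ¬ (InB k × InAB+1 k))
         × ((k : ℕ) → ¬ (InB+1 k × InAB+1 k))
lemma1 = cover , members-positive , B∩B+1 , B∩AB+1 , B+1∩AB+1
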